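{- For every diagram $S$ and every type $\theta$ of shape $S$, the set $\mathrm{Tab}(\theta)$ is nonempty.
   Context: A diagram is a finite subset $S\subset\mathbb N_{>0}^2$; $(a,b)$ is the box in row $a$, column $b$. Arm $A_S(a,b)=\{(a,k)\in S:k>b\}$, leg $L_S(a,b)=\{(k,b)\in S:k\ge a\}$, hook $H_S=A_S\cup L_S$, $h_S=|H_S|$. A tableau of shape $S$ ($|S|=n$) is a bijection $t:S\to\{1,\dots,n\}$. A type of shape $S$ is a map $\theta:S\to\mathbb Z$ with $0\le\theta(\mathfrak c)\le h_S(\mathfrak c)-1$. The type of a tableau $T$ is $\mathfrak c\mapsto|\{\mathfrak d\in H_S(\mathfrak c):t_{\mathfrak d}<t_{\mathfrak c}\}|$; $\mathrm{Tab}(\theta)$ is the set of tableaux of shape $S$ whose type is $\theta$. -}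

module Defs where

open import Data.Nat using (ℕ; _≤_; _<_; _≟_; _≤?_; _<?_)
open import Data.Product using (_×_; _,_; proj₁; proj₂; Σ; ∃)
open import Data.Sum using (_⊎_)
open import Data.List using (List; length; lookup; filter)
open import Data.List.Relation.Unary.All using (All)
open import Data.List.Relation.Unary.Unique.Propositional using (Unique)
open import Data.Fin using (Fin; toℕ)
open import Data.Fin.Base using () renaming (_<_ to _<ᶠ_)
open import Data.Fin.Properties using () renaming (_<?_ to _<ᶠ?_)
open import Data.List using (allFin)
open import Relation.Nullary using (Dec; yes; no; ¬_)
open import Relation.Nullary.Decidable using (_×-dec_; _⊎-dec_)
open import Relation.Binary.PropositionalEquality using (_≡_)
open import Function.Bundles using (Bijection; _⤖_)
open import Function using (_∘_)

-- A box (a , b) : row a, column b.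
Box : Set
Box = ℕ × ℕ

record Diagram : Set where
  field
    boxes    : List Box
    unique   : Unique boxes
    positive : All (λ c → 1 ≤ proj₁ c × 1 ≤ proj₂ c) boxes

open Diagram public

size : Diagram → ℕ
size S = length (boxes S)

box : (S : Diagram) → Fin (size S) → Box
box S i = lookup (boxes S) i

InArm : Box → Box → Set
InArm (a , b) (a' , b') = a' ≡ a × b < b'

InLeg : Box → Box → Set
InLeg (a , b) (a' , b') = b' ≡ b × a ≤ a'

InHook : Box → Box → Set
InHook c d = InArm c d ⊎ InLeg c d

inHook? : (c d : Box) → Dec (InHook c d)
inHook? (a , b) (a' , b') = ((a' ≟ a) ×-dec (b <? b')) ⊎-dec ((b' ≟ b) ×-dec (a ≤? a'))

hook : (S : Diagram) → Fin (size S) → ℕ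
hook S i = length (filter (λ j → inHook? (box S i) (box S j)) (allFin (size S)))

-- A type of shape S: θ : S → ℤ with 0 ≤ θ(c) ≤ h_S(c) - 1.
-- (Values are taken in ℕ, so 0 ≤ θ(c) is automatic; θ(c) ≤ h(c)-1 ⟺ θ(c) < h(c) since h(c) ≥ 1.)
record TypeOf (S : Diagram) : Set where
  field
    θ     : Fin (size S) → ℕ
    bound : ∀ i → θ i < hook S i

open TypeOf public

-- A tableau of shape S: a bijection S → {1,…,n}. The value set {1,…,n} is
-- represented by Fin n via k ↦ k - 1 (an order isomorphism).
Tableau : Diagram → Set
Tableau S = Fin (size S) ⤖ Fin (size S)

entry : {S : Diagram} → Tableau S → Fin (size S) → Fin (size S)
entry T = Bijection.to T

tableauType : (S : Diagram) → Tableau S → Fin (size S) → ℕ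
tableauType S T i =
  length (filter (λ j → inHook? (box S i) (box S j) ×-dec (entry {S} T j <ᶠ? entry {S} T i))
                 (allFin (size S)))

InTab : (S : Diagram) → TypeOf S → Tableau S → Set
InTab S θ' T = ∀ i → tableauType S T i ≡ θ θ' i

-- Every box of the hook H(c) other than c lies on a later antidiagonal than c
-- (it has larger a + b). So the boxes can be labelled one at a time in decreasing
-- order of a + b: when c arrives, the rest of its hook is already labelled and c
-- lies in no hook of a labelled box. Since θ(c) ≤ h(c) − 1, c can be given a fresh
-- label exceeding the labels of exactly θ(c) boxes of its hook, and this changes
-- no earlier type. Replacing the labels by their ranks gives the tableau.
module Submission where

open import Defs
open import Data.Fin as Fin using (Fin; toℕ; fromℕ<; punchOut)
open import Data.Fin.Properties
  using (any?; injective⇒≤; punchOut-injective; toℕ<n; toℕ-injective; toℕ-fromℕ<)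
  renaming (_≟_ to _≟ᶠ_; _<?_ to _<ᶠ?_)
open import Data.List using (List; []; _∷_; length; filter; allFin; lookup)
open import Data.List.Membership.Propositional using (_∈_; lose)
open import Data.List.Membership.Propositional.Properties using (∈-allFin; ∈-lookup)
open import Data.List.Properties using (filter-≐; filter-accept; filter-none; filter-notAll; length-tabulate)
open import Data.List.Relation.Unary.All as All using (_∷_)
open import Data.List.Relation.Unary.AllPairs using ([]; _∷_)
open import Data.List.Relation.Unary.Any using (here; there)
open import Data.List.Relation.Unary.Unique.Propositional using (Unique)
open import Data.List.Relation.Unary.Unique.Propositional.Properties using (allFin⁺)
open import Data.Nat as ℕ using (ℕ; zero; suc; _+_; _*_; _⊔_; _≤_; _<_; z≤n; s≤s; s≤s⁻¹)
open import Data.Nat.Properties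
open import Data.Product using (∃; _×_; _,_; proj₁; proj₂; map₂)
open import Data.Sum using (_⊎_; inj₁; inj₂)
open import Function using (_∘_; const)
open import Data.Vec.Functional using (updateAt)
open import Data.Vec.Functional.Properties using (updateAt-updates; updateAt-minimal)
open import Function.Bundles using (_⇔_; _⤖_; mk⇔; mk⤖; module Equivalence)
open import Function.Definitions using (Injective; Surjective)
open import Level using (0ℓ)
open import Relation.Binary using (tri<; tri≈; tri>)
open import Relation.Binary.PropositionalEquality
open import Relation.Nullary using (Dec; yes; no; ¬_; ¬?; contradiction)
open import Relation.Nullary.Decidable using (_×-dec_)
open import Relation.Unary using (Pred; Decidable; _⊆_; _≐_)

count : {A : Set} {P : Pred A 0ℓ} → Decidable P → List A → ℕ
count P? xs = length (filter P? xs)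

count-∷ : {A : Set} {P : Pred A 0ℓ} (P? : Decidable P) (x : A) (xs : List A) →
          count P? xs ≤ count P? (x ∷ xs)
count-∷ P? x xs with P? x
... | yes _ = n≤1+n _
... | no _  = ≤-refl

count-≤1 : {A : Set} {P : Pred A 0ℓ} (P? : Decidable P) {xs : List A} → Unique xs →
           (∀ {x y} → P x → P y → x ≡ y) → count P? xs ≤ 1
count-≤1 P? [] _ = z≤n
count-≤1 {P = P} P? {x ∷ xs} (x∉xs ∷ unique) P-subsingleton with P? x
... | yes px = s≤s (≤-reflexive (cong length (filter-none P? rest-fails)))
  where
  rest-fails : All.All (¬_ ∘ P) xs
  rest-fails = All.map (λ x≢y py → x≢y (P-subsingleton px py)) x∉xs
... | no _   = count-≤1 P? unique P-subsingleton

module _ {A : Set} {P Q : Pred A 0ℓ} (P? : Decidable P) (Q? : Decidable Q) where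

  count-≐ : P ≐ Q → ∀ xs → count P? xs ≡ count Q? xs
  count-≐ P≐Q xs = cong length (filter-≐ P? Q? P≐Q xs)

  count-mono : P ⊆ Q → ∀ xs → count P? xs ≤ count Q? xs
  count-mono P⊆Q [] = z≤n
  count-mono P⊆Q (x ∷ xs) with P? x | Q? x
  ... | yes _  | yes _   = s≤s (count-mono P⊆Q xs)
  ... | yes px | no ¬qx  = contradiction (P⊆Q px) ¬qx
  ... | no _   | yes _   = m≤n⇒m≤1+n (count-mono P⊆Q xs)
  ... | no _   | no _    = count-mono P⊆Q xs

  count-< : P ⊆ Q → ∀ {x xs} → x ∈ xs → Q x → ¬ P x → count P? xs < count Q? xs
  count-< P⊆Q {xs = y ∷ ys} (here refl) qy ¬py with P? y | Q? y
  ... | yes py | _      = contradiction py ¬py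
  ... | no _   | yes _  = s≤s (count-mono P⊆Q ys)
  ... | no _   | no ¬qy = contradiction qy ¬qy
  count-< P⊆Q {xs = y ∷ ys} (there x∈ys) qx ¬px with P? y | Q? y
  ... | yes _  | yes _  = s≤s (count-< P⊆Q x∈ys qx ¬px)
  ... | yes py | no ¬qy = contradiction (P⊆Q py) ¬qy
  ... | no _   | yes _  = m<n⇒m<1+n (count-< P⊆Q x∈ys qx ¬px)
  ... | no _   | no _   = count-< P⊆Q x∈ys qx ¬px

module _ {A : Set} {P Q R : Pred A 0ℓ} (P? : Decidable P) (Q? : Decidable Q) (R? : Decidable R) where

  count-∪ : (∀ {x} → P x → Q x ⊎ R x) → ∀ xs → count P? xs ≤ count Q? xs + count R? xs
  count-∪ P⊆Q∪R [] = z≤n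
  count-∪ P⊆Q∪R (x ∷ xs) with ih ← count-∪ P⊆Q∪R xs | P? x
  ... | no _ = ≤-trans ih (+-mono-≤ (count-∷ Q? x xs) (count-∷ R? x xs))
  ... | yes px with P⊆Q∪R px
  ...   | inj₁ qx rewrite filter-accept Q? {x} {xs} qx =
          s≤s (≤-trans ih (+-monoʳ-≤ (count Q? xs) (count-∷ R? x xs)))
  ...   | inj₂ rx rewrite filter-accept R? {x} {xs} rx | +-suc (count Q? (x ∷ xs)) (count R? xs) =
          s≤s (≤-trans ih (+-monoˡ-≤ (count R? xs) (count-∷ Q? x xs)))

lookup-injective : {A : Set} {xs : List A} → Unique xs → ∀ {i j} → lookup xs i ≡ lookup xs j → i ≡ j
lookup-injective {xs = x ∷ xs} (x∉xs ∷ _) {Fin.zero} {Fin.zero} _ = refl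
lookup-injective {xs = x ∷ xs} (x∉xs ∷ _) {Fin.zero} {Fin.suc j} x≡xⱼ =
  contradiction x≡xⱼ (All.lookup x∉xs (∈-lookup j))
lookup-injective {xs = x ∷ xs} (x∉xs ∷ _) {Fin.suc i} {Fin.zero} xᵢ≡x =
  contradiction (sym xᵢ≡x) (All.lookup x∉xs (∈-lookup i))
lookup-injective {xs = x ∷ xs} (_ ∷ unique) {Fin.suc i} {Fin.suc j} xᵢ≡xⱼ =
  cong Fin.suc (lookup-injective unique xᵢ≡xⱼ)

injective⇒surjective : ∀ {n} {f : Fin n → Fin n} → Injective _≡_ _≡_ f → Surjective _≡_ _≡_ f
injective⇒surjective {suc m} {f} f-injective y with any? (λ x → f x ≟ᶠ y)
... | yes (x , fx≡y) = x , λ { refl → fx≡y }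
... | no ∄x = contradiction (injective⇒≤ punchedOut-injective) (n≮n m)
  where
  y≢f : ∀ x → y ≢ f x
  y≢f x y≡fx = ∄x (x , sym y≡fx)

  punchedOut-injective : Injective _≡_ _≡_ (λ x → punchOut (y≢f x))
  punchedOut-injective {x} {x'} = f-injective ∘ punchOut-injective (y≢f x) (y≢f x')

bounded : ∀ {n} (f : Fin n → ℕ) → ∃ λ B → ∀ i → f i < B
bounded {zero} f = 0 , λ ()
bounded {suc n} f with B , f<B ← bounded (f ∘ Fin.suc) =
  suc (f Fin.zero) ⊔ B , λ { Fin.zero → m≤m⊔n _ B ; (Fin.suc i) → <-≤-trans (f<B i) (m≤n⊔m _ B) }

radix-< : ∀ {n a b x y} → x < n → a < b → a * n + x < b * n + y
radix-< {n} {a} {b} {x} {y} x<n a<b = begin-strict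
  a * n + x  <⟨ +-monoʳ-< (a * n) x<n ⟩
  a * n + n  ≡⟨ +-comm (a * n) n ⟩
  suc a * n  ≤⟨ *-monoˡ-≤ n a<b ⟩
  b * n      ≤⟨ m≤m+n (b * n) y ⟩
  b * n + y  ∎
  where open ≤-Reasoning

intermediate-value : (g : ℕ → ℕ) → g 0 ≡ 0 → (∀ q → g (suc q) ≤ suc (g q)) →
                     ∀ k {v} → v ≤ g k → ∃ λ p → g p ≡ v
intermediate-value g g0≡0 g-step zero v≤g0 =
  0 , trans g0≡0 (sym (n≤0⇒n≡0 (subst (_ ≤_) g0≡0 v≤g0)))
intermediate-value g g0≡0 g-step (suc k) {v} v≤gk+1 with v ℕ.≤? g k
... | yes v≤gk = intermediate-value g g0≡0 g-step k v≤gk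
... | no v≰gk  = suc k , ≤-antisym (≤-trans (g-step k) (≰⇒> v≰gk)) v≤gk+1

module _ {f : ℕ → ℕ} (f-mono : ∀ {x y} → x < y → f x < f y) where

  strictMono⇒reflects-< : ∀ {x y} → f x < f y → x < y
  strictMono⇒reflects-< {x} {y} fx<fy with <-cmp x y
  ... | tri< x<y _ _ = x<y
  ... | tri≈ _ refl _ = contradiction fx<fy (n≮n (f x))
  ... | tri> _ _ y<x = contradiction fx<fy (<-asym (f-mono y<x))

  strictMono⇒injective : ∀ {x y} → f x ≡ f y → x ≡ y
  strictMono⇒injective {x} {y} fx≡fy with <-cmp x y
  ... | tri< x<y _ _ = contradiction fx≡fy (<⇒≢ (f-mono x<y))
  ... | tri≈ _ x≡y _ = x≡y
  ... | tri> _ _ y<x = contradiction (sym fx≡fy) (<⇒≢ (f-mono y<x))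

skip : ℕ → ℕ → ℕ
skip p x with x ℕ.<? p
... | yes _ = x
... | no _  = suc x

module _ (p : ℕ) where

  skip-mono : ∀ {x y} → x < y → skip p x < skip p y
  skip-mono {x} {y} x<y with x ℕ.<? p | y ℕ.<? p
  ... | yes _   | yes _   = x<y
  ... | yes _   | no _    = m<n⇒m<1+n x<y
  ... | no x≮p  | yes y<p = contradiction (<-trans x<y y<p) x≮p
  ... | no _    | no _    = s≤s x<y

  skip-≢ : ∀ x → skip p x ≢ p
  skip-≢ x with x ℕ.<? p
  ... | yes x<p = <⇒≢ x<p
  ... | no x≮p  = λ 1+x≡p → x≮p (subst (x <_) 1+x≡p (n<1+n x))

  skip-<-⇔ : ∀ {x} → skip p x < p ⇔ x < p
  skip-<-⇔ {x} with x ℕ.<? p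
  ... | yes x<p = mk⇔ (const x<p) (const x<p)
  ... | no x≮p  = mk⇔ (<-trans (n<1+n x)) (λ x<p → contradiction x<p x≮p)

module Ranking {n : ℕ} (t : Fin n → ℕ) (t-injective : Injective _≡_ _≡_ t) where

  rankℕ : Fin n → ℕ
  rankℕ j = count (λ i → t i ℕ.<? t j) (allFin n)

  rankℕ<n : ∀ j → rankℕ j < n
  rankℕ<n j = subst (rankℕ j <_) (length-tabulate (λ i → i))
    (filter-notAll (λ i → t i ℕ.<? t j) (allFin n) (lose (∈-allFin j) (n≮n (t j))))

  rankℕ-mono : ∀ {i j} → t i < t j → rankℕ i < rankℕ j
  rankℕ-mono {i} {j} ti<tj =
    count-< (λ k → t k ℕ.<? t i) (λ k → t k ℕ.<? t j) (λ tk<ti → <-trans tk<ti ti<tj)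
            (∈-allFin i) ti<tj (n≮n (t i))

  rankℕ-reflects : ∀ {i j} → rankℕ i < rankℕ j → t i < t j
  rankℕ-reflects {i} {j} ri<rj with <-cmp (t i) (t j)
  ... | tri< ti<tj _ _ = ti<tj
  ... | tri≈ _ ti≡tj _ with refl ← t-injective ti≡tj = contradiction ri<rj (n≮n _)
  ... | tri> _ _ tj<ti = contradiction ri<rj (<-asym (rankℕ-mono tj<ti))

  rank : Fin n → Fin n
  rank j = fromℕ< (rankℕ<n j)

  rank-<-⇔ : ∀ {i j} → toℕ (rank i) < toℕ (rank j) ⇔ t i < t j
  rank-<-⇔ {i} {j} = mk⇔
    (rankℕ-reflects ∘ subst₂ _<_ (toℕ-fromℕ< _) (toℕ-fromℕ< _))
    (subst₂ _<_ (sym (toℕ-fromℕ< _)) (sym (toℕ-fromℕ< _)) ∘ rankℕ-mono)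

  rank-injective : Injective _≡_ _≡_ rank
  rank-injective {i} {j} ri≡rj with <-cmp (t i) (t j)
  ... | tri< ti<tj _ _ = contradiction ri≡rj (<⇒≢ (Equivalence.from rank-<-⇔ ti<tj) ∘ cong toℕ)
  ... | tri≈ _ ti≡tj _ = t-injective ti≡tj
  ... | tri> _ _ tj<ti = contradiction (sym ri≡rj) (<⇒≢ (Equivalence.from rank-<-⇔ tj<ti) ∘ cong toℕ)

  ranking : Fin n ⤖ Fin n
  ranking = mk⤖ (rank-injective , injective⇒surjective rank-injective)

module Realisation {n : ℕ} {H : Fin n → Fin n → Set} (H? : ∀ i j → Dec (H i j))
                   (key : Fin n → ℕ) (key-< : ∀ {i j} → i ≢ j → H i j → key i < key j)
                   (θ : Fin n → ℕ) (θ<hook : ∀ i → θ i < count (H? i) (allFin n)) where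

  typeOf : (Fin n → ℕ) → Fin n → ℕ
  typeOf label i = count (λ j → H? i j ×-dec (label j ℕ.<? label i)) (allFin n)

  -- An injective refinement of key, so that the boxes can be placed one at a time.
  prio : Fin n → ℕ
  prio i = key i * n + toℕ i

  prio-< : ∀ {i j} → i ≢ j → H i j → prio i < prio j
  prio-< {i} i≢j h = radix-< (toℕ<n i) (key-< i≢j h)

  prio-injective : ∀ {i j} → prio i ≡ prio j → i ≡ j
  prio-injective {i} {j} prio-i≡prio-j with <-cmp (key i) (key j)
  ... | tri< ki<kj _ _ = contradiction prio-i≡prio-j (<⇒≢ (radix-< (toℕ<n i) ki<kj))
  ... | tri≈ _ ki≡kj _ = toℕ-injective (+-cancelˡ-≡ (key i * n) _ _
                            (trans prio-i≡prio-j (cong (λ k → k * n + toℕ j) (sym ki≡kj))))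
  ... | tri> _ _ kj<ki = contradiction (sym prio-i≡prio-j) (<⇒≢ (radix-< (toℕ<n j) kj<ki))

  -- The boxes of priority at least s are placed; unplaced boxes carry junk labels.
  record Partial (s : ℕ) : Set where
    field
      label     : Fin n → ℕ
      injective : ∀ {i j} → s ≤ prio i → s ≤ prio j → label i ≡ label j → i ≡ j
      realises  : ∀ {i} → s ≤ prio i → typeOf label i ≡ θ i

  empty : ∀ {s} → (∀ j → prio j < s) → Partial s
  empty prio<s = record
    { label = const 0
    ; injective = λ {i} s≤prio-i _ _ → contradiction (prio<s i) (≤⇒≯ s≤prio-i)
    ; realises = λ {i} s≤prio-i → contradiction (prio<s i) (≤⇒≯ s≤prio-i) }

  weaken : ∀ {s s'} → (∀ {i} → s ≤ prio i → s' ≤ prio i) → Partial s' → Partial s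
  weaken lift P = record
    { label = label
    ; injective = λ si sj → injective (lift si) (lift sj)
    ; realises = λ si → realises (lift si) }
    where open Partial P

  module Insert {s} (P : Partial (suc s)) {c : Fin n} (prio-c≡s : prio c ≡ s) where
    open Partial P

    placed⇒≢c : ∀ {j} → suc s ≤ prio j → j ≢ c
    placed⇒≢c s<prio-c refl = <-irrefl (sym prio-c≡s) s<prio-c

    c-or-placed : ∀ {j} → s ≤ prio j → j ≡ c ⊎ suc s ≤ prio j
    c-or-placed s≤prio-j with m≤n⇒m<n∨m≡n s≤prio-j
    ... | inj₁ s<prio-j = inj₂ s<prio-j
    ... | inj₂ s≡prio-j = inj₁ (prio-injective (trans (sym s≡prio-j) (sym prio-c≡s)))

    hook-placed : ∀ {j} → j ≢ c → H c j → suc s ≤ prio j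
    hook-placed j≢c h = subst (_< prio _) prio-c≡s (prio-< (j≢c ∘ sym) h)

    c∉placedHooks : ∀ {i} → suc s ≤ prio i → ¬ H i c
    c∉placedHooks {i} s<prio-i h =
      <-asym s<prio-i (subst (prio i <_) prio-c≡s (prio-< (placed⇒≢c s<prio-i) h))

    Below : ℕ → Fin n → Set
    Below q j = H c j × j ≢ c × label j < q

    below? : ∀ q j → Dec (Below q j)
    below? q j = H? c j ×-dec ¬? (j ≟ᶠ c) ×-dec (label j ℕ.<? q)

    At : ℕ → Fin n → Set
    At q j = H c j × j ≢ c × label j ≡ q

    at? : ∀ q j → Dec (At q j)
    at? q j = H? c j ×-dec ¬? (j ≟ᶠ c) ×-dec (label j ℕ.≟ q)

    below : ℕ → ℕ
    below q = count (below? q) (allFin n)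

    below-0 : below 0 ≡ 0
    below-0 = cong length (filter-none (below? 0) (All.universal (λ { _ (_ , _ , ()) }) (allFin n)))

    below-step : ∀ q → below (suc q) ≤ suc (below q)
    below-step q = begin
      below (suc q)                    ≤⟨ count-∪ (below? (suc q)) (at? q) (below? q) split (allFin n) ⟩
      count (at? q) (allFin n) + below q ≤⟨ +-monoˡ-≤ (below q) (count-≤1 (at? q) (allFin⁺ n) at-unique) ⟩
      suc (below q)                    ∎
      where
      open ≤-Reasoning
      split : ∀ {j} → Below (suc q) j → At q j ⊎ Below q j
      split (h , j≢c , lj<q+1) with m<1+n⇒m<n∨m≡n lj<q+1
      ... | inj₁ lj<q = inj₂ (h , j≢c , lj<q)
      ... | inj₂ lj≡q = inj₁ (h , j≢c , lj≡q)
      at-unique : ∀ {i j} → At q i → At q j → i ≡ j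
      at-unique (hi , i≢c , li≡q) (hj , j≢c , lj≡q) =
        injective (hook-placed i≢c hi) (hook-placed j≢c hj) (trans li≡q (sym lj≡q))

    θ≤below : ∀ {B} → (∀ j → label j < B) → θ c ≤ below B
    θ≤below {B} label<B = s≤s⁻¹ (begin
      suc (θ c)                            ≤⟨ θ<hook c ⟩
      count (H? c) (allFin n)              ≤⟨ count-∪ (H? c) (_≟ᶠ c) (below? B) split (allFin n) ⟩
      count (_≟ᶠ c) (allFin n) + below B  ≤⟨ +-monoˡ-≤ (below B) (count-≤1 (_≟ᶠ c) (allFin⁺ n) ≡c-unique) ⟩
      suc (below B)                        ∎)
      where
      open ≤-Reasoning
      ≡c-unique : ∀ {i j} → i ≡ c → j ≡ c → i ≡ j
      ≡c-unique i≡c j≡c = trans i≡c (sym j≡c)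
      split : ∀ {j} → H c j → j ≡ c ⊎ Below B j
      split {j} h with j ≟ᶠ c
      ... | yes j≡c = inj₁ j≡c
      ... | no j≢c  = inj₂ (h , j≢c , label<B j)

    slot : ∃ λ p → below p ≡ θ c
    slot with B , label<B ← bounded label = intermediate-value below below-0 below-step B (θ≤below label<B)

    module Relabel (p : ℕ) (below-p≡θc : below p ≡ θ c) where

      label′ : Fin n → ℕ
      label′ = updateAt (skip p ∘ label) c (const p)

      label′-c : label′ c ≡ p
      label′-c = updateAt-updates c (skip p ∘ label)

      label′-≢ : ∀ {j} → j ≢ c → label′ j ≡ skip p (label j)
      label′-≢ {j} j≢c = updateAt-minimal j c (skip p ∘ label) j≢c

      label′-<-c : ∀ {j} → j ≢ c → label′ j < label′ c ⇔ label j < p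
      label′-<-c j≢c = mk⇔
        (Equivalence.to (skip-<-⇔ p) ∘ subst₂ _<_ (label′-≢ j≢c) label′-c)
        (subst₂ _<_ (sym (label′-≢ j≢c)) (sym label′-c) ∘ Equivalence.from (skip-<-⇔ p))

      label′-<-label′ : ∀ {i j} → i ≢ c → j ≢ c → label′ j < label′ i ⇔ label j < label i
      label′-<-label′ i≢c j≢c = mk⇔
        (strictMono⇒reflects-< (skip-mono p) ∘ subst₂ _<_ (label′-≢ j≢c) (label′-≢ i≢c))
        (subst₂ _<_ (sym (label′-≢ j≢c)) (sym (label′-≢ i≢c)) ∘ skip-mono p)

      label′-injective : ∀ {i j} → s ≤ prio i → s ≤ prio j → label′ i ≡ label′ j → i ≡ j
      label′-injective si sj li≡lj with c-or-placed si | c-or-placed sj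
      ... | inj₁ refl | inj₁ refl = refl
      ... | inj₁ refl | inj₂ j-placed =
        contradiction (trans (sym (label′-≢ (placed⇒≢c j-placed))) (trans (sym li≡lj) label′-c)) (skip-≢ p _)
      ... | inj₂ i-placed | inj₁ refl =
        contradiction (trans (sym (label′-≢ (placed⇒≢c i-placed))) (trans li≡lj label′-c)) (skip-≢ p _)
      ... | inj₂ i-placed | inj₂ j-placed =
        injective i-placed j-placed (strictMono⇒injective (skip-mono p)
          (trans (sym (label′-≢ (placed⇒≢c i-placed))) (trans li≡lj (label′-≢ (placed⇒≢c j-placed)))))

      label′-realises : ∀ {i} → s ≤ prio i → typeOf label′ i ≡ θ i
      label′-realises {i} si with c-or-placed si
      ... | inj₁ refl = trans (count-≐ _ (below? p) (to , from) (allFin n)) below-p≡θc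
        where
        to : ∀ {j} → H c j × label′ j < label′ c → Below p j
        to {j} (h , l′j<l′c) with j ≟ᶠ c
        ... | yes refl = contradiction l′j<l′c (n≮n _)
        ... | no j≢c   = h , j≢c , Equivalence.to (label′-<-c j≢c) l′j<l′c
        from : ∀ {j} → Below p j → H c j × label′ j < label′ c
        from (h , j≢c , lj<p) = h , Equivalence.from (label′-<-c j≢c) lj<p
      ... | inj₂ i-placed = trans (count-≐ _ _ (to , from) (allFin n)) (realises i-placed)
        where
        hook≢c : ∀ {j} → H i j → j ≢ c
        hook≢c h refl = c∉placedHooks i-placed h
        to : ∀ {j} → H i j × label′ j < label′ i → H i j × label j < label i
        to (h , lt) = h , Equivalence.to (label′-<-label′ (placed⇒≢c i-placed) (hook≢c h)) lt
        from : ∀ {j} → H i j × label j < label i → H i j × label′ j < label′ i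
        from (h , lt) = h , Equivalence.from (label′-<-label′ (placed⇒≢c i-placed) (hook≢c h)) lt

      extended : Partial s
      extended = record { label = label′ ; injective = label′-injective ; realises = label′-realises }

    extended : Partial s
    extended = Relabel.extended (proj₁ slot) (proj₂ slot)

  step : ∀ {s} → Partial (suc s) → Partial s
  step {s} P with any? (λ c → prio c ℕ.≟ s)
  ... | yes (c , prio-c≡s) = Insert.extended P prio-c≡s
  ... | no ∄c = weaken above P
    where
    above : ∀ {i} → s ≤ prio i → suc s ≤ prio i
    above {i} s≤prio-i = ≤∧≢⇒< s≤prio-i (λ s≡prio-i → ∄c (i , sym s≡prio-i))

  partial : ∀ d {s} → (∀ j → prio j < d + s) → Partial s
  partial zero     prio<s   = empty prio<s
  partial (suc d) {s} prio<1+d+s =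
    step (partial d (λ j → subst (prio j <_) (sym (+-suc d s)) (prio<1+d+s j)))

  realisation : ∃ λ (label : Fin n → ℕ) → Injective _≡_ _≡_ label × ∀ i → typeOf label i ≡ θ i
  realisation with B , prio<B ← bounded prio = label , injective z≤n z≤n , λ i → realises z≤n
    where open Partial (partial B (λ j → subst (prio j <_) (sym (+-identityʳ B)) (prio<B j)))

diagonal : Box → ℕ
diagonal (a , b) = a + b

inHook⇒diagonal-< : ∀ {c d} → c ≢ d → InHook c d → diagonal c < diagonal d
inHook⇒diagonal-< {a , b} _ (inj₁ (refl , b<b')) = +-monoʳ-< a b<b'
inHook⇒diagonal-< {a , b} c≢d (inj₂ (refl , a≤a')) =
  +-monoˡ-< b (≤∧≢⇒< a≤a' (λ { refl → c≢d refl }))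

mainTheorem5 : (S : Diagram) (θ : TypeOf S) → ∃ λ (T : Tableau S) → InTab S θ T
mainTheorem5 S θ′ = ranking , λ i → trans (same-type i) (realises i)
  where
  open Realisation (λ i j → inHook? (box S i) (box S j)) (diagonal ∘ box S)
                   (λ i≢j → inHook⇒diagonal-< (i≢j ∘ lookup-injective (unique S))) (θ θ′) (bound θ′)
  label : Fin (size S) → ℕ
  label = proj₁ realisation
  realises : ∀ i → typeOf label i ≡ θ θ′ i
  realises = proj₂ (proj₂ realisation)
  open Ranking label (proj₁ (proj₂ realisation))
  same-type : ∀ i → tableauType S ranking i ≡ typeOf label i
  same-type i = count-≐ (λ j → inHook? (box S i) (box S j) ×-dec (rank j <ᶠ? rank i))
                        (λ j → inHook? (box S i) (box S j) ×-dec (label j ℕ.<? label i))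
                        (map₂ (Equivalence.to rank-<-⇔) , map₂ (Equivalence.from rank-<-⇔))
                        (allFin (size S))
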